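{- Let $\ell\ge1$, $0\le k\le\ell$, $0\le n\le\ell$, $B=(b_1,\ldots,b_\ell)$ with integers $b_i\ge2$, and $v'\in V'_{\ell,n;B}$. Write $A=A_{\ell,k;B}$. Then: (i) $A^{\top}\mathbf x^{\ell,k,n}_{v'}=S_{\ell-k}(B(G_{v'}))\,\mathbf z^{\ell,n}_{v'}$; (ii) $A\,\mathbf z^{\ell,n}_{v'}=\mathbf x^{\ell,k,n}_{v'}$; (iii) $AA^{\top}\mathbf x^{\ell,k,n}_{v'}=S_{\ell-k}(B(G_{v'}))\,\mathbf x^{\ell,k,n}_{v'}$; (iv) $A^{\top}A\,\mathbf z^{\ell,n}_{v'}=S_{\ell-k}(B(G_{v'}))\,\mathbf z^{\ell,n}_{v'}$; (v) for any two distinct words $v\in V'_{\ell,n_1;B}$ and $u\in V'_{\ell,n_2;B}$ ($0\le n_1,n_2\le\ell$), the vectors $\mathbf x^{\ell,k,n_1}_{v}$ and $\mathbf x^{\ell,k,n_2}_{u}$ are orthogonal; (vi) for any two distinct words $v\in V'_{\ell,n_1;B}$ and $u\in V'_{\ell,n_2;B}$, the vectors $\mathbf z^{\ell,n_1}_{v}$ and $\mathbf z^{\ell,n_2}_{u}$ are orthogonal.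
   Context: For an integer $b\ge2$ let $\Sigma_b=\{0,\ldots,b-1\}$, $\Delta_b=\Sigma_b\cup\{g\}$ with $g$ a gap symbol, $\Gamma_b=\Delta_b\setminus\{0\}$; $\Sigma_B,\Delta_B,\Gamma_B$ are the products over $b_1,\ldots,b_\ell$, elements written as words $v_1\cdots v_\ell$. For $v\in\Delta_B$, $G_v=\{i: v_i=g\}$. $V_{\ell,k;B}=\{v\in\Delta_B:|G_v|=\ell-k\}$, $V'_{\ell,n;B}=\{v\in\Gamma_B:|G_v|=\ell-n\}$. $u\in\Sigma_B$ and $v\in\Delta_B$ match if $u_i=v_i$ whenever $v_i\ne g$. $A_{\ell,k;B}$ is the $(0,1)$ matrix with rows indexed by $V_{\ell,k;B}$, columns indexed by $\Sigma_B$, and entry $1$ at $(v,u)$ iff $u$ and $v$ match. For $X=\{x_1<\cdots<x_m\}\subseteq[\ell]$, $B(X)=(b_{x_1},\ldots,b_{x_m})$; $S_i$ is the $i$-th elementary symmetric polynomial ($S_0=1$, $S_i=0$ if $i$ exceeds the number of variables). On $\Delta_{b_i}$ use the order $0\prec1\prec\cdots\prec b_i-1\prec g$, and set $\nu_i(x,y)=-b_i$ if $x=y=g$; $-y$ if $x=y\ne g$; $1$ if $x\prec y$; $0$ if $y\prec x$; $\nu_B(x,y)=\prod_i\nu_i(x_i,y_i)$. For $v'\in V'_{\ell,n;B}$: $\mathbf x^{\ell,k,n}_{v'}$ is the vector indexed by $V_{\ell,k;B}$ with entries $(-1)^{\ell-k}\nu_B(w,v')$, and $\mathbf z^{\ell,n}_{v'}=\mathbf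 x^{\ell,\ell,n}_{v'}$ is the vector indexed by $\Sigma_B$ with entries $\nu_B(u,v')$. -}

module Defs where

open import Data.Nat as ℕ using (ℕ; zero; suc; _∸_; _≟_)
open import Data.Integer as ℤ using (ℤ; +_; -_; -1ℤ; 0ℤ; 1ℤ)
open import Data.Fin as Fin using (Fin; zero; suc; toℕ)
open import Data.Fin.Properties as FinP using ()
open import Data.Maybe using (Maybe; just; nothing)
open import Data.List using (List; []; _∷_; map; foldr; concatMap; allFin)
open import Relation.Nullary using (yes; no; Dec)
open import Relation.Nullary.Decidable using (⌊_⌋)
open import Relation.Binary.PropositionalEquality using (_≡_; _≢_)
open import Data.Product using (Σ; _×_)
open import Data.Bool using (Bool; true; false; if_then_else_; _∧_)

-- Δ_b : Σ_b ∪ {g};  nothing plays the role of the gap symbol g.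
Δ : ℕ → Set
Δ b = Maybe (Fin b)

ΣW : (ℓ : ℕ) → (Fin ℓ → ℕ) → Set
ΣW ℓ B = (i : Fin ℓ) → Fin (B i)

ΔW : (ℓ : ℕ) → (Fin ℓ → ℕ) → Set
ΔW ℓ B = (i : Fin ℓ) → Δ (B i)

embed : ∀ {ℓ B} → ΣW ℓ B → ΔW ℓ B
embed u i = just (u i)

allΔ : (b : ℕ) → List (Δ b)
allΔ b = nothing ∷ map just (allFin b)

consW : ∀ {ℓ} {A : Fin (suc ℓ) → Set} → A zero → ((i : Fin ℓ) → A (suc i)) → (i : Fin (suc ℓ)) → A i
consW x w zero = x
consW x w (suc i) = w i

allΣW : (ℓ : ℕ) (B : Fin ℓ → ℕ) → List (ΣW ℓ B)
allΣW zero B = (λ ()) ∷ []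
allΣW (suc ℓ) B =
  concatMap (λ x → map (consW {A = λ i → Fin (B i)} x) (allΣW ℓ (λ i → B (suc i)))) (allFin (B zero))

allΔW : (ℓ : ℕ) (B : Fin ℓ → ℕ) → List (ΔW ℓ B)
allΔW zero B = (λ ()) ∷ []
allΔW (suc ℓ) B =
  concatMap (λ x → map (consW {A = λ i → Δ (B i)} x) (allΔW ℓ (λ i → B (suc i)))) (allΔ (B zero))

isGap : ∀ {b} → Δ b → Bool
isGap nothing = true
isGap (just _) = false

gapCount : ∀ {ℓ B} → ΔW ℓ B → ℕ
gapCount {zero} v = 0
gapCount {suc ℓ} v = (if isGap (v zero) then 1 else 0) ℕ.+ gapCount {ℓ} (λ i → v (suc i))

InΓ : ∀ {ℓ B} → ΔW ℓ B → Set
InΓ {ℓ} {B} v = (i : Fin ℓ) (x : Fin (B i)) → v i ≡ just x → toℕ x ≢ 0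

InV : (ℓ k : ℕ) (B : Fin ℓ → ℕ) → ΔW ℓ B → Set
InV ℓ k B v = gapCount v ≡ ℓ ∸ k

InV' : (ℓ n : ℕ) (B : Fin ℓ → ℕ) → ΔW ℓ B → Set
InV' ℓ n B v = InΓ v × gapCount v ≡ ℓ ∸ n

sumℤ : List ℤ → ℤ
sumℤ = foldr ℤ._+_ 0ℤ

sumΣ : (ℓ : ℕ) (B : Fin ℓ → ℕ) → (ΣW ℓ B → ℤ) → ℤ
sumΣ ℓ B f = sumℤ (map f (allΣW ℓ B))

sumV : (ℓ k : ℕ) (B : Fin ℓ → ℕ) → (ΔW ℓ B → ℤ) → ℤ
sumV ℓ k B f = sumℤ (map (λ w → if ⌊ gapCount w ≟ ℓ ∸ k ⌋ then f w else 0ℤ) (allΔW ℓ B))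

matchᵢ : ∀ {b} → Fin b → Δ b → Bool
matchᵢ x nothing = true
matchᵢ x (just y) = ⌊ x Fin.≟ y ⌋

matchB : ∀ {ℓ B} → ΣW ℓ B → ΔW ℓ B → Bool
matchB {zero} u v = true
matchB {suc ℓ} u v = matchᵢ (u zero) (v zero) ∧ matchB {ℓ} (λ i → u (suc i)) (λ i → v (suc i))

-- the matrix A_{ℓ,k;B}: entry at (v,u), v ∈ V_{ℓ,k;B} (row), u ∈ Σ_B (column)
Aent : ∀ {ℓ B} → ΔW ℓ B → ΣW ℓ B → ℤ
Aent v u = if matchB u v then 1ℤ else 0ℤ

-- ν_i on Δ_{b_i} with order 0 ≺ 1 ≺ ⋯ ≺ b_i − 1 ≺ g
νᵢ : (b : ℕ) → Δ b → Δ b → ℤ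
νᵢ b nothing nothing = - (+ b)
νᵢ b (just x) nothing = 1ℤ
νᵢ b nothing (just y) = 0ℤ
νᵢ b (just x) (just y) with x Fin.≟ y
... | yes _ = - (+ toℕ y)
... | no _ = if ⌊ x Fin.<? y ⌋ then 1ℤ else 0ℤ

νB : ∀ {ℓ B} → ΔW ℓ B → ΔW ℓ B → ℤ
νB {zero} x y = 1ℤ
νB {suc ℓ} {B} x y = νᵢ (B zero) (x zero) (y zero) ℤ.* νB {ℓ} (λ i → x (suc i)) (λ i → y (suc i))

BG : ∀ {ℓ} (B : Fin ℓ → ℕ) → ΔW ℓ B → List ℕ
BG {zero} B v = []
BG {suc ℓ} B v =
  (if isGap (v zero) then (λ xs → B zero ∷ xs) else (λ xs → xs)) (BG (λ i → B (suc i)) (λ i → v (suc i)))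

esym : List ℕ → ℕ → ℕ
esym [] zero = 1
esym [] (suc i) = 0
esym (x ∷ xs) zero = 1
esym (x ∷ xs) (suc i) = x ℕ.* esym xs i ℕ.+ esym xs (suc i)

xvec : (ℓ k : ℕ) (B : Fin ℓ → ℕ) → ΔW ℓ B → ΔW ℓ B → ℤ
xvec ℓ k B v' w = (-1ℤ ℤ.^ (ℓ ∸ k)) ℤ.* νB w v'

zvec : (ℓ : ℕ) (B : Fin ℓ → ℕ) → ΔW ℓ B → ΣW ℓ B → ℤ
zvec ℓ B v' u = νB (embed u) v'

AT· : (ℓ k : ℕ) (B : Fin ℓ → ℕ) → (ΔW ℓ B → ℤ) → ΣW ℓ B → ℤ
AT· ℓ k B x u = sumV ℓ k B (λ w → Aent w u ℤ.* x w)

A· : (ℓ : ℕ) (B : Fin ℓ → ℕ) → (ΣW ℓ B → ℤ) → ΔW ℓ B → ℤ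
A· ℓ B z w = sumΣ ℓ B (λ u → Aent w u ℤ.* z u)

dotV : (ℓ k : ℕ) (B : Fin ℓ → ℕ) → (ΔW ℓ B → ℤ) → (ΔW ℓ B → ℤ) → ℤ
dotV ℓ k B x y = sumV ℓ k B (λ w → x w ℤ.* y w)

dotΣ : (ℓ : ℕ) (B : Fin ℓ → ℕ) → (ΣW ℓ B → ℤ) → (ΣW ℓ B → ℤ) → ℤ
dotΣ ℓ B x y = sumΣ ℓ B (λ u → x u ℤ.* y u)

Distinct : ∀ {ℓ B} → ΔW ℓ B → ΔW ℓ B → Set
Distinct {ℓ} v u = Σ (Fin ℓ) (λ i → v i ≢ u i)

{-# OPTIONS --safe #-}
-- Every quantity in the proposition is a product over the ℓ coordinates:
-- A(w,u) = ∏ᵢ [uᵢ matches wᵢ] and ν_B = ∏ᵢ νᵢ. So a sum over Σ_B of such a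
-- product is the product of the one-letter sums, and a sum over V_{ℓ,k;B}
-- (the words with exactly ℓ − k gaps) is the coefficient of t^{ℓ−k} in
-- ∏ᵢ (aᵢ + cᵢ t), where aᵢ is the one-letter sum over Σ_{bᵢ} and cᵢ the value
-- at the gap. Everything then reduces to identities for a single letter:
-- Σ_y νᵢ(y,c) = 0 for c ≠ g, Σ_y νᵢ(y,g) = bᵢ, νᵢ(g,c) = 0, and
-- Σ_y νᵢ(y,x) νᵢ(y,z) = 0 = νᵢ(g,x) νᵢ(g,z) for x ≠ z.
module Submission where

open import Defs
open import Data.Nat as ℕ using (ℕ; zero; suc; _≤_; _∸_)
import Data.Nat.Properties as ℕP
open import Data.Integer as ℤ using (ℤ; +_; _*_; _+_; -_; -1ℤ; 0ℤ; 1ℤ; _^_)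
import Data.Integer.Properties as ℤP
open import Data.Integer.Tactic.RingSolver using (solve-∀)
open import Data.Fin as Fin using (Fin; zero; suc; toℕ)
import Data.Fin.Properties as FinP
open import Data.Vec.Functional as Vector using (Vector)
open import Data.List using (List; []; _∷_; map; _++_; concatMap; allFin; tabulate)
import Data.List.Properties as ListP
open import Data.Bool using (Bool; true; false; if_then_else_; _∧_)
open import Data.Maybe using (just; nothing)
open import Data.Product using (_×_; _,_)
open import Data.Empty using (⊥-elim)
open import Data.Sum using (inj₁; inj₂)
open import Function using (_∘_; mk⇔)
open import Relation.Binary.Definitions using (tri<; tri≈; tri>)
open import Relation.Nullary using (Dec; yes; no; ¬_)
open import Relation.Nullary.Decidable using (⌊_⌋; isYes≗does; does-⇔)
open import Relation.Binary.PropositionalEquality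
open import Algebra.Properties.CommutativeSemigroup ℤP.*-commutativeSemigroup
  using (x∙yz≈y∙xz; interchange)
open import Algebra.Properties.Semiring.Sum ℤP.+-*-semiring
  using (sum; sum-syntax; sum-cong-≗; sum-replicate-zero; ∑-distrib-+; *-distribʳ-sum)
open ≡-Reasoning

sumℤ-++ : (xs ys : List ℤ) → sumℤ (xs ++ ys) ≡ sumℤ xs + sumℤ ys
sumℤ-++ [] ys = sym (ℤP.+-identityˡ _)
sumℤ-++ (x ∷ xs) ys = trans (cong (_+_ x) (sumℤ-++ xs ys)) (sym (ℤP.+-assoc x _ _))

module _ {A : Set} where

  sumℤ-map-cong : {f g : A → ℤ} (xs : List A) → (∀ x → f x ≡ g x) →
                  sumℤ (map f xs) ≡ sumℤ (map g xs)
  sumℤ-map-cong xs f≗g = cong sumℤ (ListP.map-cong f≗g xs)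

  sumℤ-map-zero : (f : A → ℤ) (xs : List A) → (∀ x → f x ≡ 0ℤ) → sumℤ (map f xs) ≡ 0ℤ
  sumℤ-map-zero f [] f≡0 = refl
  sumℤ-map-zero f (x ∷ xs) f≡0 = cong₂ _+_ (f≡0 x) (sumℤ-map-zero f xs f≡0)

  sumℤ-map-*ˡ : (c : ℤ) (f : A → ℤ) (xs : List A) →
                sumℤ (map (λ x → c * f x) xs) ≡ c * sumℤ (map f xs)
  sumℤ-map-*ˡ c f [] = sym (ℤP.*-zeroʳ c)
  sumℤ-map-*ˡ c f (x ∷ xs) =
    trans (cong (_+_ (c * f x)) (sumℤ-map-*ˡ c f xs)) (sym (ℤP.*-distribˡ-+ c (f x) _))

  sumℤ-map-map : {C : Set} (f : C → ℤ) (g : A → C) (xs : List A) →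
                 sumℤ (map f (map g xs)) ≡ sumℤ (map (f ∘ g) xs)
  sumℤ-map-map f g xs = cong sumℤ (sym (ListP.map-∘ xs))

  sumℤ-map-concatMap : {C : Set} (g : A → List C) (f : C → ℤ) (xs : List A) →
                       sumℤ (map f (concatMap g xs)) ≡ sumℤ (map (λ x → sumℤ (map f (g x))) xs)
  sumℤ-map-concatMap g f [] = refl
  sumℤ-map-concatMap g f (x ∷ xs) = begin
    sumℤ (map f (g x ++ concatMap g xs))
      ≡⟨ cong sumℤ (ListP.map-++ f (g x) (concatMap g xs)) ⟩
    sumℤ (map f (g x) ++ map f (concatMap g xs))
      ≡⟨ sumℤ-++ (map f (g x)) _ ⟩
    sumℤ (map f (g x)) + sumℤ (map f (concatMap g xs))
      ≡⟨ cong (_+_ (sumℤ (map f (g x)))) (sumℤ-map-concatMap g f xs) ⟩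
    sumℤ (map (λ x → sumℤ (map f (g x))) (x ∷ xs)) ∎

  sumℤ-map-tabulate : ∀ {n} (h : A → ℤ) (f : Fin n → A) →
                      sumℤ (map h (tabulate f)) ≡ ∑[ i < n ] h (f i)
  sumℤ-map-tabulate {zero} h f = refl
  sumℤ-map-tabulate {suc n} h f = cong (_+_ (h (f zero))) (sumℤ-map-tabulate h (f ∘ suc))

∑-cong : ∀ n {f g : Vector ℤ n} → (∀ i → f i ≡ g i) → sum f ≡ sum g
∑-cong n = sum-cong-≗

module _ {P : Set} {A : Set} {x y : A} where

  if-yes : (p? : Dec P) → P → (if ⌊ p? ⌋ then x else y) ≡ x
  if-yes (yes _) _ = refl
  if-yes (no ¬p) p = ⊥-elim (¬p p)

  if-no : (p? : Dec P) → ¬ P → (if ⌊ p? ⌋ then x else y) ≡ y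
  if-no (yes p) ¬p = ⊥-elim (¬p p)
  if-no (no _) _ = refl

∑-δ : ∀ {b} (c : Fin b) (h : Fin b → ℤ) → (∀ y → y ≢ c → h y ≡ 0ℤ) →
      ∑[ y < b ] h y ≡ h c
∑-δ {suc b} zero h h≡0 = begin
  h zero + ∑[ y < b ] h (suc y) ≡⟨ cong (_+_ (h zero)) (∑-cong b (λ y → h≡0 (suc y) (λ ()))) ⟩
  h zero + ∑[ y < b ] 0ℤ        ≡⟨ cong (_+_ (h zero)) (sum-replicate-zero b) ⟩
  h zero + 0ℤ                   ≡⟨ ℤP.+-identityʳ (h zero) ⟩
  h zero                        ∎
∑-δ {suc b} (suc c) h h≡0 = begin
  h zero + ∑[ y < b ] h (suc y) ≡⟨ cong (_+ ∑[ y < b ] h (suc y)) (h≡0 zero (λ ())) ⟩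
  0ℤ + ∑[ y < b ] h (suc y)     ≡⟨ ℤP.+-identityˡ _ ⟩
  ∑[ y < b ] h (suc y)          ≡⟨ ∑-δ c (h ∘ suc) (λ y y≢c → h≡0 (suc y) (y≢c ∘ FinP.suc-injective)) ⟩
  h (suc c)                     ∎

∑-1 : ∀ b → ∑[ y < b ] 1ℤ ≡ + b
∑-1 zero = refl
∑-1 (suc b) = cong (_+_ 1ℤ) (∑-1 b)

<-indicator : ∀ {b} → Fin b → Fin b → ℤ
<-indicator c y = if ⌊ y Fin.<? c ⌋ then 1ℤ else 0ℤ

∑-<-indicator : ∀ {b} (c : Fin b) → ∑[ y < b ] <-indicator c y ≡ + toℕ c
∑-<-indicator {suc b} zero = sum-replicate-zero (suc b)
∑-<-indicator {suc b} (suc c) = begin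
  <-indicator (suc c) zero + ∑[ y < b ] <-indicator (suc c) (suc y)
    ≡⟨ cong (_+_ 1ℤ) (∑-cong b (λ y → cong (if_then 1ℤ else 0ℤ) (<?-suc y))) ⟩
  1ℤ + ∑[ y < b ] <-indicator c y
    ≡⟨ cong (_+_ 1ℤ) (∑-<-indicator c) ⟩
  + suc (toℕ c) ∎
  where
  <?-suc : ∀ y → ⌊ suc y Fin.<? suc c ⌋ ≡ ⌊ y Fin.<? c ⌋
  <?-suc y = trans (isYes≗does (suc y Fin.<? suc c))
                   (trans (does-⇔ (mk⇔ ℕP.≤-pred ℕ.s≤s) (suc y Fin.<? suc c) (y Fin.<? c))
                          (sym (isYes≗does (y Fin.<? c))))

νᵢ-split : ∀ b (y c : Fin b) →
  νᵢ b (just y) (just c) ≡ (if ⌊ y Fin.≟ c ⌋ then - (+ toℕ c) else 0ℤ) + <-indicator c y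
νᵢ-split b y c with y Fin.≟ c
... | no _ = sym (ℤP.+-identityˡ _)
... | yes refl with y Fin.<? y
...   | yes y<y = ⊥-elim (ℕP.<-irrefl refl y<y)
...   | no _ = sym (ℤP.+-identityʳ _)

∑-νᵢ-letter : ∀ {b} (c : Fin b) → ∑[ y < b ] νᵢ b (just y) (just c) ≡ 0ℤ
∑-νᵢ-letter {b} c = begin
  ∑[ y < b ] νᵢ b (just y) (just c)
    ≡⟨ ∑-cong b (λ y → νᵢ-split b y c) ⟩
  ∑[ y < b ] (δ y + <-indicator c y)
    ≡⟨ ∑-distrib-+ δ (<-indicator c) ⟩
  ∑[ y < b ] δ y + ∑[ y < b ] <-indicator c y
    ≡⟨ cong₂ _+_ (trans (∑-δ c δ (λ y → if-no (y Fin.≟ c))) (if-yes (c Fin.≟ c) refl))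
                 (∑-<-indicator c) ⟩
  - (+ toℕ c) + + toℕ c
    ≡⟨ ℤP.+-inverseˡ (+ toℕ c) ⟩
  0ℤ ∎
  where
  δ : Fin b → ℤ
  δ y = if ⌊ y Fin.≟ c ⌋ then - (+ toℕ c) else 0ℤ

νᵢ-< : ∀ b (y c : Fin b) → toℕ y ℕ.< toℕ c → νᵢ b (just y) (just c) ≡ 1ℤ
νᵢ-< b y c y<c with y Fin.≟ c
... | yes refl = ⊥-elim (ℕP.<-irrefl refl y<c)
... | no _ = if-yes (y Fin.<? c) y<c

νᵢ-> : ∀ b (y c : Fin b) → toℕ c ℕ.< toℕ y → νᵢ b (just y) (just c) ≡ 0ℤ
νᵢ-> b y c c<y with y Fin.≟ c
... | yes refl = ⊥-elim (ℕP.<-irrefl refl c<y)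
... | no _ = if-no (y Fin.<? c) (ℕP.<-asym c<y)

νᵢ-absorb : ∀ b (y a c : Fin b) → toℕ a ℕ.< toℕ c →
            νᵢ b (just y) (just a) * νᵢ b (just y) (just c) ≡ νᵢ b (just y) (just a)
νᵢ-absorb b y a c a<c with ℕP.≤-<-connex (toℕ y) (toℕ a)
... | inj₁ y≤a = trans (cong (νᵢ b (just y) (just a) *_) (νᵢ-< b y c (ℕP.≤-<-trans y≤a a<c)))
                       (ℤP.*-identityʳ _)
... | inj₂ a<y = trans (cong (_* νᵢ b (just y) (just c)) (νᵢ-> b y a a<y)) (sym (νᵢ-> b y a a<y))

∑-νᵢ-orthogonal : ∀ b (x z : Δ b) → x ≢ z →
                  ∑[ y < b ] (νᵢ b (just y) x * νᵢ b (just y) z) ≡ 0ℤ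
∑-νᵢ-orthogonal b nothing nothing x≢z = ⊥-elim (x≢z refl)
∑-νᵢ-orthogonal b nothing (just c) _ =
  trans (∑-cong b (λ y → ℤP.*-identityˡ _)) (∑-νᵢ-letter c)
∑-νᵢ-orthogonal b (just c) nothing _ =
  trans (∑-cong b (λ y → ℤP.*-identityʳ _)) (∑-νᵢ-letter c)
∑-νᵢ-orthogonal b (just a) (just c) x≢z with ℕP.<-cmp (toℕ a) (toℕ c)
... | tri< a<c _ _ = trans (∑-cong b (λ y → νᵢ-absorb b y a c a<c)) (∑-νᵢ-letter a)
... | tri≈ _ a≡c _ = ⊥-elim (x≢z (cong just (FinP.toℕ-injective a≡c)))
... | tri> _ _ c<a = trans (∑-cong b (λ y → trans (ℤP.*-comm (νᵢ b (just y) (just a)) _)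
                                                   (νᵢ-absorb b y c a c<a)))
                           (∑-νᵢ-letter c)

νᵢ-gap-orthogonal : ∀ b (x z : Δ b) → x ≢ z → νᵢ b nothing x * νᵢ b nothing z ≡ 0ℤ
νᵢ-gap-orthogonal b nothing nothing x≢z = ⊥-elim (x≢z refl)
νᵢ-gap-orthogonal b nothing (just c) _ = ℤP.*-zeroʳ (- (+ b))
νᵢ-gap-orthogonal b (just c) z _ = refl

gapSign : ∀ {b} → Δ b → ℤ
gapSign x = -1ℤ ^ (if isGap x then 1 else 0)

∑-νᵢ-matching-columns : ∀ b (x z : Δ b) →
  ∑[ y < b ] (if matchᵢ y x then νᵢ b (just y) z else 0ℤ) ≡ gapSign x * νᵢ b x z
∑-νᵢ-matching-columns b (just a) z =
  trans (∑-δ a _ (λ y → if-no (y Fin.≟ a)))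
        (trans (if-yes (a Fin.≟ a) refl) (sym (ℤP.*-identityˡ _)))
∑-νᵢ-matching-columns b nothing nothing =
  trans (∑-1 b) (sym (trans (ℤP.-1*i≡-i _) (ℤP.neg-involutive (+ b))))
∑-νᵢ-matching-columns b nothing (just c) = ∑-νᵢ-letter c

∑-νᵢ-matching-rows : ∀ b (x : Fin b) (z : Δ b) →
  ∑[ y < b ] (if matchᵢ x (just y) then νᵢ b (just y) z else 0ℤ) ≡ νᵢ b (just x) z
∑-νᵢ-matching-rows b x z =
  trans (∑-δ x _ (λ y y≢x → if-no (x Fin.≟ y) (y≢x ∘ sym))) (if-yes (x Fin.≟ x) refl)

∏ : ∀ {n} → Vector ℤ n → ℤ
∏ = Vector.foldr _*_ 1ℤ

∏-cong : ∀ {n} {f g : Vector ℤ n} → (∀ i → f i ≡ g i) → ∏ f ≡ ∏ g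
∏-cong {zero} _ = refl
∏-cong {suc n} f≗g = cong₂ _*_ (f≗g zero) (∏-cong (f≗g ∘ suc))

∏-* : ∀ {n} (f g : Vector ℤ n) → ∏ (λ i → f i * g i) ≡ ∏ f * ∏ g
∏-* {zero} f g = refl
∏-* {suc n} f g = trans (cong (f zero * g zero *_) (∏-* (f ∘ suc) (g ∘ suc)))
                        (interchange (f zero) (g zero) (∏ (f ∘ suc)) (∏ (g ∘ suc)))

∏-zero : ∀ {n} (f : Vector ℤ n) (j : Fin n) → f j ≡ 0ℤ → ∏ f ≡ 0ℤ
∏-zero f zero fj≡0 = cong (_* ∏ (f ∘ suc)) fj≡0
∏-zero f (suc j) fj≡0 = trans (cong (f zero *_) (∏-zero (f ∘ suc) j fj≡0)) (ℤP.*-zeroʳ (f zero))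

νB-∏ : ∀ {ℓ B} (x y : ΔW ℓ B) → νB x y ≡ ∏ (λ i → νᵢ (B i) (x i) (y i))
νB-∏ {zero} x y = refl
νB-∏ {suc ℓ} {B} x y = cong (νᵢ (B zero) (x zero) (y zero) *_) (νB-∏ (x ∘ suc) (y ∘ suc))

νB-*-∏ : ∀ {ℓ B} (w v u : ΔW ℓ B) →
         νB w v * νB w u ≡ ∏ (λ i → νᵢ (B i) (w i) (v i) * νᵢ (B i) (w i) (u i))
νB-*-∏ {B = B} w v u = trans (cong₂ _*_ (νB-∏ w v) (νB-∏ w u))
                             (sym (∏-* (λ i → νᵢ (B i) (w i) (v i)) (λ i → νᵢ (B i) (w i) (u i))))

Aent-*-∏ : ∀ {ℓ B} (w : ΔW ℓ B) (u : ΣW ℓ B) (h : Vector ℤ ℓ) →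
           Aent w u * ∏ h ≡ ∏ (λ i → if matchᵢ (u i) (w i) then h i else 0ℤ)
Aent-*-∏ {zero} w u h = refl
Aent-*-∏ {suc ℓ} w u h = first-letter (matchᵢ (u zero) (w zero))
  where
  rest : Vector ℤ ℓ
  rest i = if matchᵢ (u (suc i)) (w (suc i)) then h (suc i) else 0ℤ
  first-letter : (matched : Bool) →
    (if matched ∧ matchB (u ∘ suc) (w ∘ suc) then 1ℤ else 0ℤ) * (h zero * ∏ (h ∘ suc))
      ≡ (if matched then h zero else 0ℤ) * ∏ rest
  first-letter true = trans (x∙yz≈y∙xz (Aent (w ∘ suc) (u ∘ suc)) (h zero) (∏ (h ∘ suc)))
                            (cong (h zero *_) (Aent-*-∏ (w ∘ suc) (u ∘ suc) (h ∘ suc)))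
  first-letter false = refl

∏-gapSign : ∀ {ℓ B} (w : ΔW ℓ B) → ∏ (λ i → gapSign (w i)) ≡ -1ℤ ^ gapCount w
∏-gapSign {zero} w = refl
∏-gapSign {suc ℓ} w =
  trans (cong (gapSign (w zero) *_) (∏-gapSign (w ∘ suc)))
        (sym (ℤP.^-distribˡ-+-* -1ℤ (if isGap (w zero) then 1 else 0) (gapCount (w ∘ suc))))

consΣ : ∀ {ℓ B} → Fin (B zero) → ΣW ℓ (B ∘ suc) → ΣW (suc ℓ) B
consΣ {B = B} = consW {A = λ i → Fin (B i)}

consΔ : ∀ {ℓ B} → Δ (B zero) → ΔW ℓ (B ∘ suc) → ΔW (suc ℓ) B
consΔ {B = B} = consW {A = λ i → Δ (B i)}

sumΣ-cons : ∀ {ℓ} B (f : ΣW (suc ℓ) B → ℤ) →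
            sumΣ (suc ℓ) B f ≡ ∑[ y < B zero ] sumΣ ℓ (B ∘ suc) (f ∘ consΣ y)
sumΣ-cons {ℓ} B f = begin
  sumℤ (map f (concatMap (λ y → map (consΣ y) words) (allFin (B zero))))
    ≡⟨ sumℤ-map-concatMap _ f (allFin (B zero)) ⟩
  sumℤ (map (λ y → sumℤ (map f (map (consΣ y) words))) (allFin (B zero)))
    ≡⟨ sumℤ-map-tabulate (λ y → sumℤ (map f (map (consΣ y) words))) (λ y → y) ⟩
  ∑[ y < B zero ] sumℤ (map f (map (consΣ y) words))
    ≡⟨ ∑-cong (B zero) (λ y → sumℤ-map-map f (consΣ y) words) ⟩
  ∑[ y < B zero ] sumΣ ℓ (B ∘ suc) (f ∘ consΣ y) ∎
  where
  words : List (ΣW ℓ (B ∘ suc))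
  words = allΣW ℓ (B ∘ suc)

sumΣ-∏ : ∀ {ℓ} (B : Fin ℓ → ℕ) (f : (i : Fin ℓ) → Fin (B i) → ℤ) →
         sumΣ ℓ B (λ u → ∏ (λ i → f i (u i))) ≡ ∏ (λ i → ∑[ y < B i ] f i y)
sumΣ-∏ {zero} B f = refl
sumΣ-∏ {suc ℓ} B f = begin
  sumΣ (suc ℓ) B (λ u → ∏ (λ i → f i (u i)))
    ≡⟨ sumΣ-cons B _ ⟩
  ∑[ y < B zero ] sumΣ ℓ (B ∘ suc) (λ u → f zero y * ∏ (λ i → f (suc i) (u i)))
    ≡⟨ ∑-cong (B zero) (λ y → trans (sumℤ-map-*ˡ (f zero y) (λ u → ∏ (λ i → f (suc i) (u i)))
                                                   (allΣW ℓ (B ∘ suc)))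
                                    (cong (f zero y *_) (sumΣ-∏ (B ∘ suc) (f ∘ suc)))) ⟩
  ∑[ y < B zero ] (f zero y * rest)
    ≡⟨ *-distribʳ-sum rest (f zero) ⟨
  (∑[ y < B zero ] f zero y) * rest ∎
  where
  rest : ℤ
  rest = ∏ (λ i → ∑[ y < B (suc i) ] f (suc i) y)

onGaps : ∀ {ℓ B} → ℕ → (ΔW ℓ B → ℤ) → ΔW ℓ B → ℤ
onGaps m f w = if ⌊ gapCount w ℕ.≟ m ⌋ then f w else 0ℤ

-- sumV ℓ k B is sumGap ℓ (ℓ ∸ k) B by definition.
sumGap : (ℓ m : ℕ) (B : Fin ℓ → ℕ) → (ΔW ℓ B → ℤ) → ℤ
sumGap ℓ m B f = sumℤ (map (onGaps m f) (allΔW ℓ B))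

sumGap-cong : ∀ {ℓ} m B {f g : ΔW ℓ B → ℤ} → (∀ w → gapCount w ≡ m → f w ≡ g w) →
              sumGap ℓ m B f ≡ sumGap ℓ m B g
sumGap-cong {ℓ} m B f≗g = sumℤ-map-cong (allΔW ℓ B) (λ w → on-V (gapCount w ℕ.≟ m) (f≗g w))
  where
  on-V : ∀ {P : Set} (p? : Dec P) {x y : ℤ} → (P → x ≡ y) →
         (if ⌊ p? ⌋ then x else 0ℤ) ≡ (if ⌊ p? ⌋ then y else 0ℤ)
  on-V (yes p) x≡y = x≡y p
  on-V (no _) _ = refl

sumGap-*ˡ : ∀ {ℓ} m B (c : ℤ) (f : ΔW ℓ B → ℤ) →
            sumGap ℓ m B (λ w → c * f w) ≡ c * sumGap ℓ m B f
sumGap-*ˡ {ℓ} m B c f =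
  trans (sumℤ-map-cong (allΔW ℓ B) (λ w → if-*ˡ ⌊ gapCount w ℕ.≟ m ⌋ (f w)))
        (sumℤ-map-*ˡ c (onGaps m f) (allΔW ℓ B))
  where
  if-*ˡ : ∀ (b : Bool) x → (if b then c * x else 0ℤ) ≡ c * (if b then x else 0ℤ)
  if-*ˡ true x = refl
  if-*ˡ false x = sym (ℤP.*-zeroʳ c)

sumGap-cons : ∀ {ℓ} m B (f : ΔW (suc ℓ) B → ℤ) →
  sumGap (suc ℓ) m B f ≡ sumℤ (map (onGaps m f ∘ consΔ nothing) (allΔW ℓ (B ∘ suc)))
                         + ∑[ y < B zero ] sumGap ℓ m (B ∘ suc) (f ∘ consΔ (just y))
sumGap-cons {ℓ} m B f = begin
  sumℤ (map (onGaps m f) (concatMap (λ x → map (consΔ x) words) (allΔ (B zero))))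
    ≡⟨ sumℤ-map-concatMap (λ x → map (consΔ x) words) (onGaps m f) (allΔ (B zero)) ⟩
  onLetter nothing + sumℤ (map onLetter (map just (allFin (B zero))))
    ≡⟨ cong₂ _+_ (sumℤ-map-map (onGaps m f) (consΔ nothing) words)
                 (trans (sumℤ-map-map onLetter just (allFin (B zero)))
                        (sumℤ-map-tabulate (onLetter ∘ just) (λ y → y))) ⟩
  sumℤ (map (onGaps m f ∘ consΔ nothing) words) + ∑[ y < B zero ] onLetter (just y)
    ≡⟨ cong (_+_ (sumℤ (map (onGaps m f ∘ consΔ nothing) words)))
            (∑-cong (B zero) (λ y → sumℤ-map-map (onGaps m f) (consΔ (just y)) words)) ⟩
  sumℤ (map (onGaps m f ∘ consΔ nothing) words)
    + ∑[ y < B zero ] sumGap ℓ m (B ∘ suc) (f ∘ consΔ (just y)) ∎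
  where
  words : List (ΔW ℓ (B ∘ suc))
  words = allΔW ℓ (B ∘ suc)
  onLetter : Δ (B zero) → ℤ
  onLetter x = sumℤ (map (onGaps m f) (map (consΔ x) words))

sumGap-cons-zero : ∀ {ℓ} B (f : ΔW (suc ℓ) B → ℤ) →
  sumGap (suc ℓ) 0 B f ≡ ∑[ y < B zero ] sumGap ℓ 0 (B ∘ suc) (f ∘ consΔ (just y))
sumGap-cons-zero {ℓ} B f =
  trans (sumGap-cons 0 B f)
        (trans (cong (_+ ∑[ y < B zero ] sumGap ℓ 0 (B ∘ suc) (f ∘ consΔ (just y)))
                     (sumℤ-map-zero (onGaps 0 f ∘ consΔ nothing) (allΔW ℓ (B ∘ suc)) (λ _ → refl)))
               (ℤP.+-identityˡ _))

sumGap-cons-suc : ∀ {ℓ} m B (f : ΔW (suc ℓ) B → ℤ) →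
  sumGap (suc ℓ) (suc m) B f ≡ sumGap ℓ m (B ∘ suc) (f ∘ consΔ nothing)
                               + ∑[ y < B zero ] sumGap ℓ (suc m) (B ∘ suc) (f ∘ consΔ (just y))
sumGap-cons-suc {ℓ} m B f =
  trans (sumGap-cons (suc m) B f)
        (cong (_+ ∑[ y < B zero ] sumGap ℓ (suc m) (B ∘ suc) (f ∘ consΔ (just y)))
              (sumℤ-map-cong (allΔW ℓ (B ∘ suc))
                             (λ w → cong (if_then f (consΔ nothing w) else 0ℤ) (≟-suc (gapCount w)))))
  where
  ≟-suc : ∀ n → ⌊ suc n ℕ.≟ suc m ⌋ ≡ ⌊ n ℕ.≟ m ⌋
  ≟-suc n = trans (isYes≗does (suc n ℕ.≟ suc m))
                  (trans (does-⇔ (mk⇔ ℕP.suc-injective (cong suc)) (suc n ℕ.≟ suc m) (n ℕ.≟ m))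
                         (sym (isYes≗does (n ℕ.≟ m))))

-- The coefficient of tᵐ in ∏ᵢ (a i + c i t).
prodCoeff : ∀ {ℓ} → Vector ℤ ℓ → Vector ℤ ℓ → ℕ → ℤ
prodCoeff {zero} a c zero = 1ℤ
prodCoeff {zero} a c (suc m) = 0ℤ
prodCoeff {suc ℓ} a c zero = a zero * prodCoeff (a ∘ suc) (c ∘ suc) zero
prodCoeff {suc ℓ} a c (suc m) =
  c zero * prodCoeff (a ∘ suc) (c ∘ suc) m + a zero * prodCoeff (a ∘ suc) (c ∘ suc) (suc m)

prodCoeff-zero-degree : ∀ {ℓ} (a c : Vector ℤ ℓ) → prodCoeff a c 0 ≡ ∏ a
prodCoeff-zero-degree {zero} a c = refl
prodCoeff-zero-degree {suc ℓ} a c = cong (a zero *_) (prodCoeff-zero-degree (a ∘ suc) (c ∘ suc))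

prodCoeff-cong : ∀ {ℓ} {a a′ : Vector ℤ ℓ} (c : Vector ℤ ℓ) → (∀ i → a i ≡ a′ i) →
                 ∀ m → prodCoeff a c m ≡ prodCoeff a′ c m
prodCoeff-cong {zero} c a≗a′ zero = refl
prodCoeff-cong {zero} c a≗a′ (suc m) = refl
prodCoeff-cong {suc ℓ} c a≗a′ zero =
  cong₂ _*_ (a≗a′ zero) (prodCoeff-cong (c ∘ suc) (a≗a′ ∘ suc) zero)
prodCoeff-cong {suc ℓ} c a≗a′ (suc m) =
  cong₂ _+_ (cong (c zero *_) (prodCoeff-cong (c ∘ suc) (a≗a′ ∘ suc) m))
            (cong₂ _*_ (a≗a′ zero) (prodCoeff-cong (c ∘ suc) (a≗a′ ∘ suc) (suc m)))

prodCoeff-vanishing-factor : ∀ {ℓ} (a c : Vector ℤ ℓ) (j : Fin ℓ) → a j ≡ 0ℤ → c j ≡ 0ℤ →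
                             ∀ m → prodCoeff a c m ≡ 0ℤ
prodCoeff-vanishing-factor a c zero aj≡0 cj≡0 zero =
  cong (_* prodCoeff (a ∘ suc) (c ∘ suc) zero) aj≡0
prodCoeff-vanishing-factor a c zero aj≡0 cj≡0 (suc m) =
  cong₂ _+_ (cong (_* prodCoeff (a ∘ suc) (c ∘ suc) m) cj≡0)
            (cong (_* prodCoeff (a ∘ suc) (c ∘ suc) (suc m)) aj≡0)
prodCoeff-vanishing-factor a c (suc j) aj≡0 cj≡0 zero =
  trans (cong (a zero *_) (prodCoeff-vanishing-factor (a ∘ suc) (c ∘ suc) j aj≡0 cj≡0 zero))
        (ℤP.*-zeroʳ (a zero))
prodCoeff-vanishing-factor a c (suc j) aj≡0 cj≡0 (suc m) =
  cong₂ _+_ (trans (cong (c zero *_) (tail-vanishes m)) (ℤP.*-zeroʳ (c zero)))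
            (trans (cong (a zero *_) (tail-vanishes (suc m))) (ℤP.*-zeroʳ (a zero)))
  where
  tail-vanishes : ∀ m → prodCoeff (a ∘ suc) (c ∘ suc) m ≡ 0ℤ
  tail-vanishes = prodCoeff-vanishing-factor (a ∘ suc) (c ∘ suc) j aj≡0 cj≡0

sumGap-∏ : ∀ {ℓ} m (B : Fin ℓ → ℕ) (f : (i : Fin ℓ) → Δ (B i) → ℤ) →
  sumGap ℓ m B (λ w → ∏ (λ i → f i (w i)))
    ≡ prodCoeff (λ i → ∑[ y < B i ] f i (just y)) (λ i → f i nothing) m
sumGap-∏ {zero} zero B f = refl
sumGap-∏ {zero} (suc m) B f = refl
sumGap-∏ {suc ℓ} m B f = by-degree m
  where
  F′ : ΔW ℓ (B ∘ suc) → ℤ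
  F′ w = ∏ (λ i → f (suc i) (w i))
  a′ c′ : Vector ℤ ℓ
  a′ i = ∑[ y < B (suc i) ] f (suc i) (just y)
  c′ i = f (suc i) nothing
  letters : ∀ m → ∑[ y < B zero ] sumGap ℓ m (B ∘ suc) (λ w → f zero (just y) * F′ w)
                  ≡ (∑[ y < B zero ] f zero (just y)) * prodCoeff a′ c′ m
  letters m = begin
    ∑[ y < B zero ] sumGap ℓ m (B ∘ suc) (λ w → f zero (just y) * F′ w)
      ≡⟨ ∑-cong (B zero) (λ y → trans (sumGap-*ˡ m (B ∘ suc) (f zero (just y)) F′)
                                      (cong (f zero (just y) *_) (sumGap-∏ m (B ∘ suc) (f ∘ suc)))) ⟩
    ∑[ y < B zero ] (f zero (just y) * prodCoeff a′ c′ m)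
      ≡⟨ *-distribʳ-sum (prodCoeff a′ c′ m) (λ y → f zero (just y)) ⟨
    (∑[ y < B zero ] f zero (just y)) * prodCoeff a′ c′ m ∎
  by-degree : ∀ m → sumGap (suc ℓ) m B (λ w → ∏ (λ i → f i (w i)))
                    ≡ prodCoeff (λ i → ∑[ y < B i ] f i (just y)) (λ i → f i nothing) m
  by-degree zero = trans (sumGap-cons-zero B _) (letters zero)
  by-degree (suc m) =
    trans (sumGap-cons-suc m B _)
          (cong₂ _+_ (trans (sumGap-*ˡ m (B ∘ suc) (f zero nothing) F′)
                            (cong (f zero nothing *_) (sumGap-∏ m (B ∘ suc) (f ∘ suc))))
                     (letters (suc m)))

esym-zero : ∀ xs → esym xs 0 ≡ 1
esym-zero [] = refl
esym-zero (x ∷ xs) = refl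

-- In ∏ᵢ (aᵢ + cᵢ t) with aᵢ = νᵢ(uᵢ,vᵢ) and cᵢ = νᵢ(g,vᵢ), a letter vᵢ gives the
-- constant factor νᵢ(uᵢ,vᵢ) and a gap gives 1 − bᵢ t; this produces (−1)ᵐ Sₘ(B(G_v)).
prodCoeff-νᵢ : ∀ {ℓ} (B : Fin ℓ → ℕ) (u : ΣW ℓ B) (v : ΔW ℓ B) m →
  prodCoeff (λ i → νᵢ (B i) (just (u i)) (v i)) (λ i → νᵢ (B i) nothing (v i)) m
    ≡ (-1ℤ ^ m) * (+ esym (BG B v) m * νB (embed u) v)
prodCoeff-νᵢ B u v zero = begin
  prodCoeff (λ i → νᵢ (B i) (just (u i)) (v i)) (λ i → νᵢ (B i) nothing (v i)) 0
    ≡⟨ prodCoeff-zero-degree _ (λ i → νᵢ (B i) nothing (v i)) ⟩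
  ∏ (λ i → νᵢ (B i) (just (u i)) (v i))
    ≡⟨ νB-∏ (embed u) v ⟨
  νB (embed u) v
    ≡⟨ ℤP.*-identityˡ _ ⟨
  + 1 * νB (embed u) v
    ≡⟨ cong (λ e → + e * νB (embed u) v) (esym-zero (BG B v)) ⟨
  + esym (BG B v) 0 * νB (embed u) v
    ≡⟨ ℤP.*-identityˡ _ ⟨
  1ℤ * (+ esym (BG B v) 0 * νB (embed u) v) ∎
prodCoeff-νᵢ {zero} B u v (suc m) = sym (ℤP.*-zeroʳ (-1ℤ ^ suc m))
prodCoeff-νᵢ {suc ℓ} B u v (suc m) = by-first-letter (v zero)
  where
  b : ℕ
  b = B zero
  P : ℕ → ℤ
  P = prodCoeff (λ i → νᵢ (B (suc i)) (just (u (suc i))) (v (suc i)))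
                (λ i → νᵢ (B (suc i)) nothing (v (suc i)))
  L : List ℕ
  L = BG (B ∘ suc) (v ∘ suc)
  N : ℤ
  N = νB (embed (u ∘ suc)) (v ∘ suc)
  s : ℤ
  s = -1ℤ ^ m
  IH : ∀ m → P m ≡ (-1ℤ ^ m) * (+ esym L m * N)
  IH = prodCoeff-νᵢ (B ∘ suc) (u ∘ suc) (v ∘ suc)
  gap-factor : ∀ b s p q N →
    - b * (s * (p * N)) + 1ℤ * ((-1ℤ * s) * (q * N)) ≡ (-1ℤ * s) * ((b * p + q) * (1ℤ * N))
  gap-factor = solve-∀
  by-first-letter : (x : Δ b) →
    νᵢ b nothing x * P m + νᵢ b (just (u zero)) x * P (suc m)
      ≡ (-1ℤ * s) * (+ esym ((if isGap x then (λ xs → b ∷ xs) else (λ xs → xs)) L) (suc m)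
                     * (νᵢ b (just (u zero)) x * N))
  by-first-letter nothing = begin
    - (+ b) * P m + 1ℤ * P (suc m)
      ≡⟨ cong₂ (λ p q → - (+ b) * p + 1ℤ * q) (IH m) (IH (suc m)) ⟩
    - (+ b) * (s * (+ esym L m * N)) + 1ℤ * ((-1ℤ * s) * (+ esym L (suc m) * N))
      ≡⟨ gap-factor (+ b) s (+ esym L m) (+ esym L (suc m)) N ⟩
    (-1ℤ * s) * ((+ b * + esym L m + + esym L (suc m)) * (1ℤ * N))
      ≡⟨ cong (λ e → (-1ℤ * s) * (e * (1ℤ * N)))
              (trans (ℤP.pos-+ (b ℕ.* esym L m) (esym L (suc m)))
                     (cong (_+ + esym L (suc m)) (ℤP.pos-* b (esym L m)))) ⟨
    (-1ℤ * s) * (+ (b ℕ.* esym L m ℕ.+ esym L (suc m)) * (1ℤ * N)) ∎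
  by-first-letter (just c) = begin
    0ℤ + νᵢ b (just (u zero)) (just c) * P (suc m)
      ≡⟨ ℤP.+-identityˡ _ ⟩
    νᵢ b (just (u zero)) (just c) * P (suc m)
      ≡⟨ cong (νᵢ b (just (u zero)) (just c) *_) (IH (suc m)) ⟩
    νᵢ b (just (u zero)) (just c) * ((-1ℤ * s) * (+ esym L (suc m) * N))
      ≡⟨ x∙yz≈y∙xz (νᵢ b (just (u zero)) (just c)) (-1ℤ * s) (+ esym L (suc m) * N) ⟩
    (-1ℤ * s) * (νᵢ b (just (u zero)) (just c) * (+ esym L (suc m) * N))
      ≡⟨ cong ((-1ℤ * s) *_) (x∙yz≈y∙xz (νᵢ b (just (u zero)) (just c)) (+ esym L (suc m)) N) ⟩
    (-1ℤ * s) * (+ esym L (suc m) * (νᵢ b (just (u zero)) (just c) * N)) ∎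

sumGap-Aent-νB : ∀ {ℓ} m (B : Fin ℓ → ℕ) (v : ΔW ℓ B) (u : ΣW ℓ B) →
  sumGap ℓ m B (λ w → Aent w u * νB w v) ≡ (-1ℤ ^ m) * (+ esym (BG B v) m * νB (embed u) v)
sumGap-Aent-νB {ℓ} m B v u = begin
  sumGap ℓ m B (λ w → Aent w u * νB w v)
    ≡⟨ sumGap-cong m B (λ w _ → trans (cong (Aent w u *_) (νB-∏ w v)) (Aent-*-∏ w u _)) ⟩
  sumGap ℓ m B (λ w → ∏ (λ i → if matchᵢ (u i) (w i) then νᵢ (B i) (w i) (v i) else 0ℤ))
    ≡⟨ sumGap-∏ m B (λ i x → if matchᵢ (u i) x then νᵢ (B i) x (v i) else 0ℤ) ⟩
  prodCoeff (λ i → ∑[ y < B i ] (if matchᵢ (u i) (just y) then νᵢ (B i) (just y) (v i) else 0ℤ))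
            (λ i → νᵢ (B i) nothing (v i)) m
    ≡⟨ prodCoeff-cong (λ i → νᵢ (B i) nothing (v i))
                      (λ i → ∑-νᵢ-matching-rows (B i) (u i) (v i)) m ⟩
  prodCoeff (λ i → νᵢ (B i) (just (u i)) (v i)) (λ i → νᵢ (B i) nothing (v i)) m
    ≡⟨ prodCoeff-νᵢ B u v m ⟩
  (-1ℤ ^ m) * (+ esym (BG B v) m * νB (embed u) v) ∎

sumΣ-Aent-νB : ∀ {ℓ} (B : Fin ℓ → ℕ) (v w : ΔW ℓ B) →
  sumΣ ℓ B (λ u → Aent w u * νB (embed u) v) ≡ (-1ℤ ^ gapCount w) * νB w v
sumΣ-Aent-νB {ℓ} B v w = begin
  sumΣ ℓ B (λ u → Aent w u * νB (embed u) v)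
    ≡⟨ sumℤ-map-cong (allΣW ℓ B) (λ u → trans (cong (Aent w u *_) (νB-∏ (embed u) v))
                                              (Aent-*-∏ w u _)) ⟩
  sumΣ ℓ B (λ u → ∏ (λ i → if matchᵢ (u i) (w i) then νᵢ (B i) (just (u i)) (v i) else 0ℤ))
    ≡⟨ sumΣ-∏ B (λ i y → if matchᵢ y (w i) then νᵢ (B i) (just y) (v i) else 0ℤ) ⟩
  ∏ (λ i → ∑[ y < B i ] (if matchᵢ y (w i) then νᵢ (B i) (just y) (v i) else 0ℤ))
    ≡⟨ ∏-cong (λ i → ∑-νᵢ-matching-columns (B i) (w i) (v i)) ⟩
  ∏ (λ i → gapSign (w i) * νᵢ (B i) (w i) (v i))
    ≡⟨ ∏-* (λ i → gapSign (w i)) (λ i → νᵢ (B i) (w i) (v i)) ⟩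
  ∏ (λ i → gapSign (w i)) * ∏ (λ i → νᵢ (B i) (w i) (v i))
    ≡⟨ cong₂ _*_ (∏-gapSign w) (sym (νB-∏ w v)) ⟩
  (-1ℤ ^ gapCount w) * νB w v ∎

sumGap-νB-orthogonal : ∀ {ℓ} m (B : Fin ℓ → ℕ) (v u : ΔW ℓ B) → Distinct v u →
                       sumGap ℓ m B (λ w → νB w v * νB w u) ≡ 0ℤ
sumGap-νB-orthogonal m B v u (j , vj≢uj) =
  trans (sumGap-cong m B (λ w _ → νB-*-∏ w v u))
        (trans (sumGap-∏ m B (λ i x → νᵢ (B i) x (v i) * νᵢ (B i) x (u i)))
               (prodCoeff-vanishing-factor _ _ j (∑-νᵢ-orthogonal (B j) (v j) (u j) vj≢uj)
                                                 (νᵢ-gap-orthogonal (B j) (v j) (u j) vj≢uj) m))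

sumΣ-νB-orthogonal : ∀ {ℓ} (B : Fin ℓ → ℕ) (v u : ΔW ℓ B) → Distinct v u →
                     sumΣ ℓ B (λ x → νB (embed x) v * νB (embed x) u) ≡ 0ℤ
sumΣ-νB-orthogonal {ℓ} B v u (j , vj≢uj) =
  trans (sumℤ-map-cong (allΣW ℓ B) (λ x → νB-*-∏ (embed x) v u))
        (trans (sumΣ-∏ B (λ i y → νᵢ (B i) (just y) (v i) * νᵢ (B i) (just y) (u i)))
               (∏-zero _ j (∑-νᵢ-orthogonal (B j) (v j) (u j) vj≢uj)))

-1^m*-1^m≡1 : ∀ m → -1ℤ ^ m * -1ℤ ^ m ≡ 1ℤ
-1^m*-1^m≡1 zero = refl
-1^m*-1^m≡1 (suc m) =
  trans (interchange -1ℤ (-1ℤ ^ m) -1ℤ (-1ℤ ^ m)) (trans (ℤP.*-identityˡ _) (-1^m*-1^m≡1 m))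

-1^m*-1^m*x≡x : ∀ m x → -1ℤ ^ m * (-1ℤ ^ m * x) ≡ x
-1^m*-1^m*x≡x m x =
  trans (sym (ℤP.*-assoc (-1ℤ ^ m) (-1ℤ ^ m) x))
        (trans (cong (_* x) (-1^m*-1^m≡1 m)) (ℤP.*-identityˡ x))

module _ (ℓ k : ℕ) (B : Fin ℓ → ℕ) (v : ΔW ℓ B) where

  private
    s : ℤ
    s = -1ℤ ^ (ℓ ∸ k)
    S : ℤ
    S = + esym (BG B v) (ℓ ∸ k)

  Aᵀx≡S·z : (u : ΣW ℓ B) → AT· ℓ k B (xvec ℓ k B v) u ≡ S * zvec ℓ B v u
  Aᵀx≡S·z u = begin
    sumGap ℓ (ℓ ∸ k) B (λ w → Aent w u * (s * νB w v))
      ≡⟨ sumGap-cong (ℓ ∸ k) B (λ w _ → x∙yz≈y∙xz (Aent w u) s (νB w v)) ⟩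
    sumGap ℓ (ℓ ∸ k) B (λ w → s * (Aent w u * νB w v))
      ≡⟨ sumGap-*ˡ (ℓ ∸ k) B s (λ w → Aent w u * νB w v) ⟩
    s * sumGap ℓ (ℓ ∸ k) B (λ w → Aent w u * νB w v)
      ≡⟨ cong (s *_) (sumGap-Aent-νB (ℓ ∸ k) B v u) ⟩
    s * (s * (S * zvec ℓ B v u))
      ≡⟨ -1^m*-1^m*x≡x (ℓ ∸ k) (S * zvec ℓ B v u) ⟩
    S * zvec ℓ B v u ∎

  Az≡x : (w : ΔW ℓ B) → InV ℓ k B w → A· ℓ B (zvec ℓ B v) w ≡ xvec ℓ k B v w
  Az≡x w w∈V = trans (sumΣ-Aent-νB B v w) (cong (λ g → -1ℤ ^ g * νB w v) w∈V)

  AAᵀx≡S·x : (w : ΔW ℓ B) → InV ℓ k B w →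
             A· ℓ B (AT· ℓ k B (xvec ℓ k B v)) w ≡ S * xvec ℓ k B v w
  AAᵀx≡S·x w w∈V = begin
    sumΣ ℓ B (λ u → Aent w u * AT· ℓ k B (xvec ℓ k B v) u)
      ≡⟨ sumℤ-map-cong (allΣW ℓ B) (λ u → trans (cong (Aent w u *_) (Aᵀx≡S·z u))
                                                (x∙yz≈y∙xz (Aent w u) S (zvec ℓ B v u))) ⟩
    sumΣ ℓ B (λ u → S * (Aent w u * zvec ℓ B v u))
      ≡⟨ sumℤ-map-*ˡ S (λ u → Aent w u * zvec ℓ B v u) (allΣW ℓ B) ⟩
    S * A· ℓ B (zvec ℓ B v) w
      ≡⟨ cong (S *_) (Az≡x w w∈V) ⟩
    S * xvec ℓ k B v w ∎

  AᵀAz≡S·z : (u : ΣW ℓ B) → AT· ℓ k B (A· ℓ B (zvec ℓ B v)) u ≡ S * zvec ℓ B v u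
  AᵀAz≡S·z u =
    trans (sumGap-cong (ℓ ∸ k) B (λ w w∈V → cong (Aent w u *_) (Az≡x w w∈V))) (Aᵀx≡S·z u)

xvec-orthogonal : ∀ ℓ k (B : Fin ℓ → ℕ) (v u : ΔW ℓ B) → Distinct v u →
                  dotV ℓ k B (xvec ℓ k B v) (xvec ℓ k B u) ≡ 0ℤ
xvec-orthogonal ℓ k B v u v≢u = begin
  sumGap ℓ (ℓ ∸ k) B (λ w → (s * νB w v) * (s * νB w u))
    ≡⟨ sumGap-cong (ℓ ∸ k) B (λ w _ → interchange s (νB w v) s (νB w u)) ⟩
  sumGap ℓ (ℓ ∸ k) B (λ w → (s * s) * (νB w v * νB w u))
    ≡⟨ sumGap-*ˡ (ℓ ∸ k) B (s * s) (λ w → νB w v * νB w u) ⟩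
  (s * s) * sumGap ℓ (ℓ ∸ k) B (λ w → νB w v * νB w u)
    ≡⟨ cong ((s * s) *_) (sumGap-νB-orthogonal (ℓ ∸ k) B v u v≢u) ⟩
  (s * s) * 0ℤ
    ≡⟨ ℤP.*-zeroʳ (s * s) ⟩
  0ℤ ∎
  where
  s : ℤ
  s = -1ℤ ^ (ℓ ∸ k)

-- The identities hold for every B and every v′ ∈ Δ_B.
proposition5 : (ℓ k n : ℕ) → 1 ≤ ℓ → k ≤ ℓ → n ≤ ℓ →
    (B : Fin ℓ → ℕ) → ((i : Fin ℓ) → 2 ≤ B i) →
    (v' : ΔW ℓ B) → InV' ℓ n B v' →
    ((u : ΣW ℓ B) → AT· ℓ k B (xvec ℓ k B v') u ≡ + esym (BG B v') (ℓ ∸ k) * zvec ℓ B v' u)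
    × ((w : ΔW ℓ B) → InV ℓ k B w → A· ℓ B (zvec ℓ B v') w ≡ xvec ℓ k B v' w)
    × ((w : ΔW ℓ B) → InV ℓ k B w →
         A· ℓ B (AT· ℓ k B (xvec ℓ k B v')) w ≡ + esym (BG B v') (ℓ ∸ k) * xvec ℓ k B v' w)
    × ((u : ΣW ℓ B) →
         AT· ℓ k B (A· ℓ B (zvec ℓ B v')) u ≡ + esym (BG B v') (ℓ ∸ k) * zvec ℓ B v' u)
    × ((n₁ n₂ : ℕ) → n₁ ≤ ℓ → n₂ ≤ ℓ → (v u : ΔW ℓ B) → InV' ℓ n₁ B v → InV' ℓ n₂ B u →
         Distinct v u → dotV ℓ k B (xvec ℓ k B v) (xvec ℓ k B u) ≡ + 0)
    × ((n₁ n₂ : ℕ) → n₁ ≤ ℓ → n₂ ≤ ℓ → (v u : ΔW ℓ B) → InV' ℓ n₁ B v → InV' ℓ n₂ B u →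
         Distinct v u → dotΣ ℓ B (zvec ℓ B v) (zvec ℓ B u) ≡ + 0)
proposition5 ℓ k n _ _ _ B _ v' _ =
    Aᵀx≡S·z ℓ k B v'
  , Az≡x ℓ k B v'
  , AAᵀx≡S·x ℓ k B v'
  , AᵀAz≡S·z ℓ k B v'
  , (λ _ _ _ _ v u _ _ → xvec-orthogonal ℓ k B v u)
  , (λ _ _ _ _ v u _ _ → sumΣ-νB-orthogonal B v u)
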